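{- For every closed $\mathrm{BCCSP}_{\|}$ term $p$ there is a closed BCCSP term $q$ (one with no occurrence of $\|$) such that $\mathcal{E}_{\mathtt{RT}}\vdash p\approx q$, where $\mathcal{E}_{\mathtt{RT}}=\mathcal{E}_1\cup\{\mathrm{RT},\mathrm{FP},\mathrm{EL2}\}$.
   Context: Let $\mathcal{A}$ be a finite non-empty set of actions and $\mathcal{V}$ a countably infinite set of variables. $\mathrm{BCCSP}_{\|}$ terms: $t ::= \mathbf{0} \mid x \mid a.t \mid t+t \mid t \,\|\, t$ ($a\in\mathcal{A}$, $x \in \mathcal{V}$; $ax$ means $a.x$); BCCSP terms are those without $\|$; closed terms contain no variables. $\mathcal{E}\vdash t\approx u$: derivable in equational logic (reflexivity, symmetry, transitivity, substitution instances of axioms, closure under $a.\_$, $+$, $\|$). Axioms with concrete action names stand for all instances with actions from $\mathcal{A}$; $\sum$ over an empty set is $\mathbf{0}$. $\mathcal{E}_1$: A0 $x+\mathbf{0}\approx x$; A1 $x+y\approx y+x$; A2 $(x+y)+z \approx x+(y+z)$; A3 $x+x\approx x$; P0 $x\|\mathbf{0}\approx x$; P1 $x\|y \approx y \| x$. RT: $a(\sum_{i=1}^{|\mathcal{A}|}(b_ix_i+b_iy_i)+z)\approx a(\sum_{i=1}^{|\mathcal{A}|}b_ix_i+z)+a(\sum_{i=1}^{|\mathcal{A}|}b_iy_i+z)$ for all $a,b_1,\dots,b_{|\mathcal{A}|}\in\mathcal{A}$. FP: $(ax+ay+w)\|z\approx(ax+w)\|z+(ay+w)\|z$. EL2: $\sum_{i\in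 I} a_ix_i \| \sum_{j\in J} b_jy_j \approx \sum_{i\in I} a_i(x_i \| \sum_{j\in J} b_j y_j) + \sum_{j\in J} b_j(\sum_{i\in I} a_i x_i \| y_j)$ for finite $I,J$ with the $a_i$ pairwise distinct and the $b_j$ pairwise distinct. -}

module Defs where

open import Data.Nat using (ℕ; suc)
open import Data.Fin using (Fin)
open import Data.List using (List; []; _∷_; map)
open import Data.Vec.Functional using (Vector)
open import Data.Product using (_×_; _,_; proj₁; proj₂)
open import Data.Bool using (Bool; true; false)
open import Data.List.Relation.Unary.Unique.Propositional using (Unique)
open import Data.List.Relation.Unary.All using (All)

-- Actions: a finite non-empty set, modelled as Fin (suc k) (|A| = suc k).
-- Variables: ℕ (countably infinite).
module _ (k : ℕ) where

  Act : Set
  Act = Fin (suc k)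

  data Term : Set where
    𝟎   : Term
    var : ℕ → Term
    _∙_ : Act → Term → Term
    _⊕_ : Term → Term → Term
    _∥_ : Term → Term → Term

  infixr 7 _∙_
  infixr 5 _⊕_
  infixr 6 _∥_

  data Closed : Term → Set where
    c𝟎 : Closed 𝟎
    c∙ : ∀ {a t} → Closed t → Closed (a ∙ t)
    c⊕ : ∀ {t u} → Closed t → Closed u → Closed (t ⊕ u)
    c∥ : ∀ {t u} → Closed t → Closed u → Closed (t ∥ u)

  data BCCSP : Term → Set where
    b𝟎   : BCCSP 𝟎
    bvar : ∀ {x} → BCCSP (var x)
    b∙   : ∀ {a t} → BCCSP t → BCCSP (a ∙ t)
    b⊕   : ∀ {t u} → BCCSP t → BCCSP u → BCCSP (t ⊕ u)

  Σ' : List Term → Term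
  Σ' []       = 𝟎
  Σ' (t ∷ ts) = t ⊕ Σ' ts

  Σp : List (Act × Term) → Term
  Σp ps = Σ' (map (λ p → proj₁ p ∙ proj₂ p) ps)

  ΣA : (Fin (suc k) → Term) → Term
  ΣA f = Σ' (Data.List.tabulate f)

  Subst : Set
  Subst = ℕ → Term

  _[_] : Term → Subst → Term
  𝟎 [ σ ]       = 𝟎
  var x [ σ ]   = σ x
  (a ∙ t) [ σ ] = a ∙ (t [ σ ])
  (t ⊕ u) [ σ ] = (t [ σ ]) ⊕ (u [ σ ])
  (t ∥ u) [ σ ] = (t [ σ ]) ∥ (u [ σ ])

  -- The axioms of E_RT = E1 ∪ {RT, FP, EL2}; the schema variables are
  -- arbitrary terms (i.e. these are all the substitution instances).
  data Ax-RT : Term → Term → Set where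
    A0  : ∀ x → Ax-RT (x ⊕ 𝟎) x
    A1  : ∀ x y → Ax-RT (x ⊕ y) (y ⊕ x)
    A2  : ∀ x y z → Ax-RT ((x ⊕ y) ⊕ z) (x ⊕ (y ⊕ z))
    A3  : ∀ x → Ax-RT (x ⊕ x) x
    P0  : ∀ x → Ax-RT (x ∥ 𝟎) x
    P1  : ∀ x y → Ax-RT (x ∥ y) (y ∥ x)
    RT  : ∀ (a : Act) (b : Fin (suc k) → Act) (xs ys : Fin (suc k) → Term) (z : Term) →
          Ax-RT (a ∙ (ΣA (λ i → (b i ∙ xs i) ⊕ (b i ∙ ys i)) ⊕ z))
                ((a ∙ (ΣA (λ i → b i ∙ xs i) ⊕ z)) ⊕ (a ∙ (ΣA (λ i → b i ∙ ys i) ⊕ z)))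
    FP  : ∀ (a : Act) x y w z →
          Ax-RT (((a ∙ x) ⊕ (a ∙ y) ⊕ w) ∥ z)
                ((((a ∙ x) ⊕ w) ∥ z) ⊕ (((a ∙ y) ⊕ w) ∥ z))
    EL2 : ∀ (ps qs : List (Act × Term)) →
          Unique (map proj₁ ps) → Unique (map proj₁ qs) →
          Ax-RT (Σp ps ∥ Σp qs)
                (Σ' (map (λ p → proj₁ p ∙ (proj₂ p ∥ Σp qs)) ps)
                  ⊕ Σ' (map (λ q → proj₁ q ∙ (Σp ps ∥ proj₂ q)) qs))

  data _⊢_≈_ (E : Term → Term → Set) : Term → Term → Set where
    refl  : ∀ {t} → E ⊢ t ≈ t
    sym   : ∀ {t u} → E ⊢ t ≈ u → E ⊢ u ≈ t
    trans : ∀ {t u v} → E ⊢ t ≈ u → E ⊢ u ≈ v → E ⊢ t ≈ v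
    ax    : ∀ {t u} → E t u → (σ : Subst) → E ⊢ (t [ σ ]) ≈ (u [ σ ])
    pre   : ∀ {t u} (a : Act) → E ⊢ t ≈ u → E ⊢ (a ∙ t) ≈ (a ∙ u)
    plus  : ∀ {t t' u u'} → E ⊢ t ≈ t' → E ⊢ u ≈ u' → E ⊢ (t ⊕ u) ≈ (t' ⊕ u')
    par   : ∀ {t t' u u'} → E ⊢ t ≈ t' → E ⊢ u ≈ u' → E ⊢ (t ∥ u) ≈ (t' ∥ u')

-- Closed BCCSP terms are the normal forms. Their summands are prefixes a t, so
-- to eliminate a parallel composition of two normal forms we look at the
-- actions of the summands on both sides: if one side has two summands with the
-- same action, FP splits the product into two lighter products; otherwise EL2
-- applies and leaves, under each prefix, a product in which one factor has lost
-- its outermost prefix. Both steps strictly decrease the total size of the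
-- factors, so the elimination terminates.
module Submission where

open import Defs
open import Data.Nat using (ℕ; suc; _+_; _≤_; _<_; s≤s; z<s)
open import Data.Nat.Properties
  using (<-≤-trans; n<1+n; m≤m+n; m≤n+m; m<n+m; +-comm; +-identityʳ; +-monoˡ-<; +-monoʳ-<)
open import Data.Nat.ListAction using (sum)
open import Data.Nat.ListAction.Properties using (sum-++; sum-↭)
open import Data.Product using (Σ; ∃; _×_; _,_; proj₁; proj₂)
open import Data.Sum using (_⊎_; inj₁; inj₂)
open import Data.List using (List; []; _∷_; map; _++_)
open import Data.List.Properties using (map-++)
open import Data.List.Relation.Unary.All using (All; []; _∷_; lookup)
open import Data.List.Relation.Unary.All.Properties using (++⁺; map⁺)
open import Data.List.Relation.Unary.Any using (here; there)
open import Data.List.Membership.Propositional using (_∈_)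
open import Data.List.Relation.Unary.Unique.Propositional using (Unique)
open import Data.List.Relation.Unary.AllPairs using ([]; _∷_)
open import Data.List.Relation.Binary.Permutation.Propositional as ↭ using (_↭_; prep; swap)
open import Data.List.Relation.Binary.Permutation.Propositional.Properties as ↭ₚ using (All-resp-↭)
open import Data.Fin using (_≟_)
open import Function using (_∘_)
open import Relation.Binary.Bundles using (Setoid)
import Relation.Binary.Reasoning.Setoid as SetoidReasoning
open import Relation.Binary.PropositionalEquality as ≡ using (_≡_; _≢_)
open import Relation.Nullary using (yes; no)

module Normalisation (k : ℕ) where

  Prefix : Set
  Prefix = Act k × Term k

  private
    variable
      t u : Term k

  infix 4 _≈_
  _≈_ : Term k → Term k → Set
  _≈_ = _⊢_≈_ k (Ax-RT k)

  ≈-setoid : Setoid _ _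
  ≈-setoid = record
    { Carrier       = Term k
    ; _≈_           = _≈_
    ; isEquivalence = record { refl = refl ; sym = sym ; trans = trans }
    }

  open SetoidReasoning ≈-setoid

  subst-var : (t : Term k) → _[_] k t var ≡ t
  subst-var 𝟎       = ≡.refl
  subst-var (var x) = ≡.refl
  subst-var (a ∙ t) = ≡.cong (a ∙_) (subst-var t)
  subst-var (t ⊕ u) = ≡.cong₂ _⊕_ (subst-var t) (subst-var u)
  subst-var (t ∥ u) = ≡.cong₂ _∥_ (subst-var t) (subst-var u)

  axiom : Ax-RT k t u → t ≈ u
  axiom {t} {u} e = ≡.subst₂ _≈_ (subst-var t) (subst-var u) (ax e var)

  ⊕-identityˡ : 𝟎 ⊕ t ≈ t
  ⊕-identityˡ = trans (axiom (A1 _ _)) (axiom (A0 _))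

  ⊕-assoc : ∀ t u v → (t ⊕ u) ⊕ v ≈ t ⊕ (u ⊕ v)
  ⊕-assoc t u v = axiom (A2 t u v)

  ⊕-leftComm : ∀ t u v → t ⊕ (u ⊕ v) ≈ u ⊕ (t ⊕ v)
  ⊕-leftComm t u v = begin
    t ⊕ (u ⊕ v)  ≈⟨ sym (⊕-assoc t u v) ⟩
    (t ⊕ u) ⊕ v  ≈⟨ plus (axiom (A1 t u)) refl ⟩
    (u ⊕ t) ⊕ v  ≈⟨ ⊕-assoc u t v ⟩
    u ⊕ (t ⊕ v)  ∎

  data Normal : Term k → Set where
    𝟎ⁿ   : Normal 𝟎
    _∙ⁿ_ : ∀ a {t} → Normal t → Normal (a ∙ t)
    _⊕ⁿ_ : ∀ {t u} → Normal t → Normal u → Normal (t ⊕ u)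

  Normal⇒Closed : Normal t → Closed k t
  Normal⇒Closed 𝟎ⁿ       = c𝟎
  Normal⇒Closed (a ∙ⁿ n) = c∙ (Normal⇒Closed n)
  Normal⇒Closed (n ⊕ⁿ o) = c⊕ (Normal⇒Closed n) (Normal⇒Closed o)

  Normal⇒BCCSP : Normal t → BCCSP k t
  Normal⇒BCCSP 𝟎ⁿ       = b𝟎
  Normal⇒BCCSP (a ∙ⁿ n) = b∙ (Normal⇒BCCSP n)
  Normal⇒BCCSP (n ⊕ⁿ o) = b⊕ (Normal⇒BCCSP n) (Normal⇒BCCSP o)

  Normalisable : Term k → Set
  Normalisable t = Σ (Term k) λ r → Normal r × t ≈ r

  ∙-normalisable : ∀ a → Normalisable t → Normalisable (a ∙ t)
  ∙-normalisable a (r , n , e) = a ∙ r , a ∙ⁿ n , pre a e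

  ⊕-normalisable : Normalisable t → Normalisable u → Normalisable (t ⊕ u)
  ⊕-normalisable (r , n , e) (s , o , f) = r ⊕ s , n ⊕ⁿ o , plus e f

  ≈-normalisable : t ≈ u → Normalisable u → Normalisable t
  ≈-normalisable e (r , n , f) = r , n , trans e f

  Σ'-normalisable : (f : Prefix → Term k) (ps : List Prefix) →
                    (∀ {p} → p ∈ ps → Normalisable (f p)) → Normalisable (Σ' k (map f ps))
  Σ'-normalisable f []       h = 𝟎 , 𝟎ⁿ , refl
  Σ'-normalisable f (p ∷ ps) h =
    ⊕-normalisable (h (here ≡.refl)) (Σ'-normalisable f ps (h ∘ there))

  summands : Term k → List Prefix
  summands (a ∙ t) = (a , t) ∷ []
  summands (t ⊕ u) = summands t ++ summands u
  summands _       = []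

  NormalPrefixes : List Prefix → Set
  NormalPrefixes = All (Normal ∘ proj₂)

  summands-normal : Normal t → NormalPrefixes (summands t)
  summands-normal 𝟎ⁿ       = []
  summands-normal (a ∙ⁿ n) = n ∷ []
  summands-normal (n ⊕ⁿ o) = ++⁺ (summands-normal n) (summands-normal o)

  Σp-++ : ∀ ps qs → Σp k (ps ++ qs) ≈ Σp k ps ⊕ Σp k qs
  Σp-++ []             qs = sym ⊕-identityˡ
  Σp-++ ((a , t) ∷ ps) qs = trans (plus refl (Σp-++ ps qs)) (sym (⊕-assoc _ _ _))

  Σp-summands : Normal t → Σp k (summands t) ≈ t
  Σp-summands 𝟎ⁿ                 = refl
  Σp-summands (a ∙ⁿ n)           = axiom (A0 _)
  Σp-summands (_⊕ⁿ_ {t} {u} n o) =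
    trans (Σp-++ (summands t) (summands u)) (plus (Σp-summands n) (Σp-summands o))

  Σp-↭ : ∀ {ps qs} → ps ↭ qs → Σp k ps ≈ Σp k qs
  Σp-↭ ↭.refl                 = refl
  Σp-↭ (prep p ps↭qs)         = plus refl (Σp-↭ ps↭qs)
  Σp-↭ (swap p q ps↭qs)       = trans (⊕-leftComm _ _ _) (plus refl (plus refl (Σp-↭ ps↭qs)))
  Σp-↭ (↭.trans ps↭qs qs↭rs) = trans (Σp-↭ ps↭qs) (Σp-↭ qs↭rs)

  size : Term k → ℕ
  size (a ∙ t) = suc (size t)
  size (t ⊕ u) = size t + size u
  size _       = 0

  weight : List Prefix → ℕ
  weight = sum ∘ map (suc ∘ size ∘ proj₂)

  weight-++ : ∀ ps qs → weight (ps ++ qs) ≡ weight ps + weight qs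
  weight-++ ps qs = ≡.trans (≡.cong sum (map-++ f ps qs)) (sum-++ (map f ps) (map f qs))
    where f = suc ∘ size ∘ proj₂

  weight-summands : ∀ t → weight (summands t) ≡ size t
  weight-summands 𝟎       = ≡.refl
  weight-summands (var x) = ≡.refl
  weight-summands (a ∙ t) = ≡.cong suc (+-identityʳ (size t))
  weight-summands (t ⊕ u) =
    ≡.trans (weight-++ (summands t) (summands u)) (≡.cong₂ _+_ (weight-summands t) (weight-summands u))
  weight-summands (t ∥ u) = ≡.refl

  weight-↭ : ∀ {ps qs} → ps ↭ qs → weight ps ≡ weight qs
  weight-↭ = sum-↭ ∘ ↭ₚ.map⁺ _

  summands-lighter : ∀ {a t ps} → (a , t) ∈ ps → weight (summands t) < weight ps
  summands-lighter {a} {t} {_ ∷ ps} (here ≡.refl) =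
    ≡.subst (_< weight ((a , t) ∷ ps)) (≡.sym (weight-summands t)) (s≤s (m≤m+n (size t) (weight ps)))
  summands-lighter {ps = (_ , s) ∷ ps} (there t∈ps) =
    <-≤-trans (summands-lighter t∈ps) (m≤n+m (weight ps) (suc (size s)))

  weight-dropFirst : ∀ p rest → weight rest < weight (p ∷ rest)
  weight-dropFirst p rest = m<n+m (weight rest) z<s

  weight-dropSecond : ∀ p q rest → weight (p ∷ rest) < weight (p ∷ q ∷ rest)
  weight-dropSecond (_ , t) q rest = +-monoʳ-< (suc (size t)) (weight-dropFirst q rest)

  SharedAction : List Prefix → Set
  SharedAction ps = Σ (Act k) λ a → ∃ λ x → ∃ λ y → ∃ λ rest → ps ↭ (a , x) ∷ (a , y) ∷ rest

  extract : (a : Act k) (ps : List Prefix) →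
            (∃ λ y → ∃ λ rest → ps ↭ (a , y) ∷ rest) ⊎ All (λ p → a ≢ proj₁ p) ps
  extract a []             = inj₂ []
  extract a ((b , y) ∷ ps) with a ≟ b
  ... | yes ≡.refl = inj₁ (y , ps , ↭.refl)
  ... | no a≢b with extract a ps
  ...   | inj₁ (y′ , rest , ps↭) = inj₁ (y′ , (b , y) ∷ rest , ↭.trans (prep _ ps↭) (swap _ _ ↭.refl))
  ...   | inj₂ fresh          = inj₂ (a≢b ∷ fresh)

  unique⊎shared : (ps : List Prefix) → Unique (map proj₁ ps) ⊎ SharedAction ps
  unique⊎shared []             = inj₁ []
  unique⊎shared ((a , x) ∷ ps) with extract a ps
  ... | inj₁ (y , rest , ps↭) = inj₂ (a , x , y , rest , prep _ ps↭)
  ... | inj₂ fresh with unique⊎shared ps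
  ...   | inj₁ unique = inj₁ (map⁺ fresh ∷ unique)
  ...   | inj₂ (b , x′ , y′ , rest , ps↭) =
          inj₂ (b , x′ , y′ , (a , x) ∷ rest ,
                ↭.trans (prep _ ps↭) (↭.trans (swap _ _ ↭.refl) (prep _ (swap _ _ ↭.refl))))

  ParNormalisable : ℕ → Set
  ParNormalisable n = ∀ ps qs → NormalPrefixes ps → NormalPrefixes qs →
                      weight ps + weight qs < n → Normalisable (Σp k ps ∥ Σp k qs)

  fp-split : ∀ {n} → ParNormalisable n → ∀ a x y rest qs →
             NormalPrefixes ((a , x) ∷ (a , y) ∷ rest) → NormalPrefixes qs →
             weight ((a , x) ∷ (a , y) ∷ rest) + weight qs ≤ n →
             Normalisable (Σp k ((a , x) ∷ (a , y) ∷ rest) ∥ Σp k qs)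
  fp-split ih a x y rest qs (nx ∷ ny ∷ nrest) nqs bound =
    ≈-normalisable (axiom (FP a x y (Σp k rest) (Σp k qs)))
      (⊕-normalisable (ih xs qs (nx ∷ nrest) nqs (lighter xs (weight-dropSecond (a , x) (a , y) rest)))
                      (ih ys qs (ny ∷ nrest) nqs (lighter ys (weight-dropFirst (a , x) ys))))
    where
      xs ys : List Prefix
      xs = (a , x) ∷ rest
      ys = (a , y) ∷ rest

      lighter : ∀ ps → weight ps < weight ((a , x) ∷ (a , y) ∷ rest) → weight ps + weight qs < _
      lighter ps lt = <-≤-trans (+-monoˡ-< (weight qs) lt) bound

  shared-split : ∀ {n} → ParNormalisable n → ∀ {ps} → SharedAction ps → ∀ qs →
                 NormalPrefixes ps → NormalPrefixes qs → weight ps + weight qs ≤ n →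
                 Normalisable (Σp k ps ∥ Σp k qs)
  shared-split ih (a , x , y , rest , ps↭) qs nps nqs bound =
    ≈-normalisable (par (Σp-↭ ps↭) refl)
      (fp-split ih a x y rest qs (All-resp-↭ ps↭ nps) nqs
        (≡.subst (λ w → w + weight qs ≤ _) (weight-↭ ps↭) bound))

  el2-expand : ∀ {n} → ParNormalisable n → ∀ ps qs →
               Unique (map proj₁ ps) → Unique (map proj₁ qs) →
               NormalPrefixes ps → NormalPrefixes qs → weight ps + weight qs ≤ n →
               Normalisable (Σp k ps ∥ Σp k qs)
  el2-expand ih ps qs ups uqs nps nqs bound =
    ≈-normalisable (axiom (EL2 ps qs ups uqs))
      (⊕-normalisable (Σ'-normalisable _ ps left) (Σ'-normalisable _ qs right))
    where
      left : ∀ {p} → p ∈ ps → Normalisable (proj₁ p ∙ (proj₂ p ∥ Σp k qs))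
      left {a , x} x∈ps =
        ∙-normalisable a (≈-normalisable (par (sym (Σp-summands nx)) refl)
          (ih (summands x) qs (summands-normal nx) nqs
            (<-≤-trans (+-monoˡ-< (weight qs) (summands-lighter x∈ps)) bound)))
        where
          nx : Normal x
          nx = lookup nps x∈ps

      right : ∀ {q} → q ∈ qs → Normalisable (proj₁ q ∙ (Σp k ps ∥ proj₂ q))
      right {b , y} y∈qs =
        ∙-normalisable b (≈-normalisable (par refl (sym (Σp-summands ny)))
          (ih ps (summands y) nps (summands-normal ny)
            (<-≤-trans (+-monoʳ-< (weight ps) (summands-lighter y∈qs)) bound)))
        where
          ny : Normal y
          ny = lookup nqs y∈qs

  par-normalisable : ∀ n → ParNormalisable n
  par-normalisable (suc n) ps qs nps nqs (s≤s bound) with unique⊎shared ps | unique⊎shared qs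
  ... | inj₂ shared | _ = shared-split (par-normalisable n) shared qs nps nqs bound
  ... | inj₁ _ | inj₂ shared =
    ≈-normalisable (axiom (P1 _ _))
      (shared-split (par-normalisable n) shared ps nqs nps
        (≡.subst (_≤ n) (+-comm (weight ps) (weight qs)) bound))
  ... | inj₁ ups | inj₁ uqs = el2-expand (par-normalisable n) ps qs ups uqs nps nqs bound

  ∥-normalisable : Normal t → Normal u → Normalisable (t ∥ u)
  ∥-normalisable {t} {u} n o =
    ≈-normalisable (par (sym (Σp-summands n)) (sym (Σp-summands o)))
      (par-normalisable _ (summands t) (summands u) (summands-normal n) (summands-normal o) (n<1+n _))

  normalisable : Closed k t → Normalisable t
  normalisable c𝟎         = 𝟎 , 𝟎ⁿ , refl
  normalisable (c∙ {a} c) = ∙-normalisable a (normalisable c)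
  normalisable (c⊕ c d)   = ⊕-normalisable (normalisable c) (normalisable d)
  normalisable (c∥ c d) with normalisable c | normalisable d
  ... | r , nr , e | s , ns , f = ≈-normalisable (par e f) (∥-normalisable nr ns)

open Normalisation using (Normal⇒Closed; Normal⇒BCCSP; normalisable)

proposition5p3 : (k : ℕ) (p : Term k) → Closed k p →
    Σ (Term k) (λ q → Closed k q × BCCSP k q × _⊢_≈_ k (Ax-RT k) p q)
proposition5p3 k p c with normalisable k c
... | q , nq , e = q , Normal⇒Closed k nq , Normal⇒BCCSP k nq , e
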